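{- For positive integers $n,m$, the relation $\leq$ on $\mathcal{G}(n,m)$ is a partial order.
   Context: A mixed graph on $[n]$ has, between any two distinct vertices, at most one of: an arc $\vec{ij}$, an undirected edge $ij$, or nothing; its adjacency matrix $A$ has $a_{ij}=1$ iff $\vec{ij}$ or $ij$ is in $E$. The size is the number of arcs plus twice the number of undirected edges. $\mathcal{G}(n,m)$ is the set of isomorphism classes $[G]$ of mixed graphs $G$ of order $n$ and size $m$. For distinct vertices $a,b$ of $G$ with no arc between them, the Kelmans transformation $G_b^a$ is the mixed graph with adjacency matrix $A'$ where, for $i\notin\{a,b\}$, $a'_{ia}=\max(a_{ia},a_{ib})$, $a'_{ib}=\min(a_{ia},a_{ib})$, $a'_{ai}=\max(a_{ai},a_{bi})$, $a'_{bi}=\min(a_{ai},a_{bi})$, and all other entries equal those of $A$ (this preserves order and size). The relation is: $[G]\leq[H]$ iff $H$ is isomorphic to $G$ or $H$ is isomorphic to a graph obtained from $G$ by a finite sequence of Kelmans transformations. -}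

module Defs where

open import Data.Nat using (ℕ; _+_)
open import Data.Bool using (Bool; true; false; _∨_; _∧_; if_then_else_)
open import Data.Fin using (Fin; _≟_)
open import Data.List using (List; map)
open import Data.Nat.ListAction using (sum)
open import Data.List.Base using (allFin)
open import Data.Fin.Permutation using (Permutation′; _⟨$⟩ʳ_)
open import Data.Product using (Σ; ∃; _×_)
open import Relation.Nullary using (¬_; does)
open import Relation.Binary.PropositionalEquality using (_≡_)
open import Relation.Binary.Construct.Closure.ReflexiveTransitive using (Star)

Matrix : ℕ → Set
Matrix n = Fin n → Fin n → Bool

-- A mixed graph on [n] is determined by its adjacency matrix:
-- a_ij = a_ji = 1 : undirected edge ij;  a_ij = 1, a_ji = 0 : arc ij;
-- a_ij = a_ji = 0 : nothing.  Every loopless 0/1 matrix arises this way.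
record MixedGraph (n : ℕ) : Set where
  field
    adj      : Matrix n
    loopless : ∀ i → adj i i ≡ false
open MixedGraph public

b2n : Bool → ℕ
b2n true  = 1
b2n false = 0

-- size = #arcs + 2 #undirected edges = number of 1-entries of A
size : ∀ {n} → Matrix n → ℕ
size {n} A = sum (map (λ i → sum (map (λ j → b2n (A i j)) (allFin n))) (allFin n))

-- elements of 𝒢(n,m) (representatives; classes are taken up to _≅_)
record MG (n m : ℕ) : Set where
  field
    graph  : MixedGraph n
    sizeIs : size (adj graph) ≡ m
open MG public

_≅ᴹ_ : ∀ {n} → Matrix n → Matrix n → Set
_≅ᴹ_ {n} A B = Σ (Permutation′ n) λ σ → ∀ i j → B (σ ⟨$⟩ʳ i) (σ ⟨$⟩ʳ j) ≡ A i j

_==_ : ∀ {n} → Fin n → Fin n → Bool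
i == j = does (i ≟ j)

kelmans : ∀ {n} → Matrix n → Fin n → Fin n → Matrix n
kelmans A a b i j =
  if i == a then (if (j == a) ∨ (j == b) then A i j else (A a j ∨ A b j))
  else if i == b then (if (j == a) ∨ (j == b) then A i j else (A a j ∧ A b j))
  else if j == a then (A i a ∨ A i b)
  else if j == b then (A i a ∧ A i b)
  else A i j

-- one Kelmans step: a ≠ b, no arc between a and b (a_ab = a_ba), B = A^a_b
KStep : ∀ {n} → Matrix n → Matrix n → Set
KStep {n} A B = Σ (Fin n) λ a → Σ (Fin n) λ b →
  (¬ a ≡ b) × (A a b ≡ A b a) × (∀ i j → B i j ≡ kelmans A a b i j)

_≼_ : ∀ {n m} → MG n m → MG n m → Set
G ≼ H = ∃ λ K → Star KStep (adj (graph G)) K × (K ≅ᴹ adj (graph H))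

_≅_ : ∀ {n m} → MG n m → MG n m → Set
G ≅ H = adj (graph G) ≅ᴹ adj (graph H)

{-# OPTIONS --safe #-}
-- The potential of a matrix is the sum over vertices of the square of the
-- total degree (arcs counted once, undirected edges twice).  It is invariant
-- under isomorphism.  A Kelmans step G ↦ G^a_b fixes every degree except those
-- of a and b, keeps d(a) + d(b), and makes the new d(a) at least the old d(a)
-- and d(b); so the potential grows by 2 (d'(a) − d(a)) (d'(a) − d(b)).  If it
-- does not grow, d'(a) equals d(a) or d(b), which forces one of the rows (and
-- columns) of a and b to absorb the other, and then G^a_b is G itself or G with
-- a and b swapped.  Hence G ≤ H ≤ G makes every step trivial and G ≅ H.
-- Transitivity holds because a Kelmans sequence can be replayed along an
-- isomorphism.
module Submission where

open import Defs
open import Data.Nat using (ℕ; zero; suc; _<_; _+_; _*_; _∸_; _≤_; z≤n)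
open import Data.Nat.Properties
  using ( +-comm; +-assoc; +-identityʳ; +-cancelˡ-≡; +-cancelʳ-≡; +-cancelˡ-≤; +-cancelʳ-≤
        ; +-mono-≤; +-monoˡ-≤; +-monoʳ-≤; ≤-refl; ≤-reflexive; ≤-trans; ≤-antisym; m≤m+n
        ; m+[n∸m]≡n; m∸n≡0⇒m≤n; m*n≡0⇒m≡0∨n≡0; +-0-commutativeMonoid; +-commutativeSemigroup )
open import Data.Bool using (true; false; _∨_; _∧_)
open import Data.Fin using (Fin; zero; suc; _≟_)
open import Data.Fin.Properties using (suc-injective)
open import Data.Fin.Permutation
  using (Permutation′; _⟨$⟩ʳ_; _⟨$⟩ˡ_; transpose; id; flip; _∘ₚ_; inverseˡ; inverseʳ)
open import Data.Vec.Functional using (updateAt)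
open import Data.Vec.Functional.Properties using (updateAt-updates; updateAt-minimal)
open import Data.Product using (∃; _×_; _,_; proj₁; proj₂)
open import Data.Empty using (⊥-elim)
open import Data.Sum using (_⊎_; inj₁; inj₂)
open import Function using (_∘_)
open import Relation.Nullary using (yes; no)
open import Relation.Nullary.Decidable using (dec-true; dec-false)
open import Relation.Binary.PropositionalEquality
open import Relation.Binary.Structures using (IsEquivalence; IsPartialOrder)
open import Relation.Binary.Construct.Closure.ReflexiveTransitive using (Star; ε; _◅_; _◅◅_)
import Relation.Binary.Construct.On as On
open import Algebra.Properties.CommutativeMonoid.Sum +-0-commutativeMonoid
  using (sum; sum-cong-≗; sum-permute; ∑-distrib-+)
open import Algebra.Properties.CommutativeSemigroup +-commutativeSemigroup
  using (interchange; xy∙z≈xz∙y; xy∙z≈zy∙x; x∙yz≈xz∙y)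
open import Data.Nat.Tactic.RingSolver using (solve-∀)

open ≡-Reasoning

private
  variable
    n : ℕ

+-mono-≤-rigid : ∀ {a b c d} → a ≤ c → b ≤ d → c + d ≡ a + b → c ≡ a × d ≡ b
+-mono-≤-rigid {a} {b} {c} {d} a≤c b≤d eq =
  ≤-antisym (+-cancelʳ-≤ d c a (≤-trans (≤-reflexive eq) (+-monoʳ-≤ a b≤d))) a≤c ,
  ≤-antisym (+-cancelˡ-≤ c d b (≤-trans (≤-reflexive eq) (+-monoˡ-≤ b a≤c))) b≤d

square-gap-identity : ∀ q d e →
  (q + e + d) * (q + e + d) + q * q ≡ (q + e) * (q + e) + (q + d) * (q + d) + 2 * d * e
square-gap-identity = solve-∀

square-gap : ∀ {p q x y} → p + q ≡ x + y → x ≤ p → y ≤ p →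
  p * p + q * q ≡ x * x + y * y + 2 * (p ∸ x) * (p ∸ y)
square-gap {p} {q} {x} {y} eq x≤p y≤p = begin
  p * p + q * q
    ≡⟨ cong (λ t → t * t + q * q) p≡q+e+d ⟩
  (q + e + d) * (q + e + d) + q * q
    ≡⟨ square-gap-identity q d e ⟩
  (q + e) * (q + e) + (q + d) * (q + d) + 2 * d * e
    ≡⟨ cong₂ (λ s t → s * s + t * t + 2 * d * e) (sym x≡q+e) (sym y≡q+d) ⟩
  x * x + y * y + 2 * d * e ∎
  where
  d e : ℕ
  d = p ∸ x
  e = p ∸ y
  p≡x+d : p ≡ x + d
  p≡x+d = sym (m+[n∸m]≡n x≤p)
  y≡q+d : y ≡ q + d
  y≡q+d = +-cancelˡ-≡ x y (q + d) (begin
    x + y       ≡⟨ sym eq ⟩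
    p + q       ≡⟨ cong (_+ q) p≡x+d ⟩
    x + d + q   ≡⟨ +-assoc x d q ⟩
    x + (d + q) ≡⟨ cong (x +_) (+-comm d q) ⟩
    x + (q + d) ∎)
  x≡q+e : x ≡ q + e
  x≡q+e = +-cancelʳ-≡ d x (q + e) (begin
    x + d       ≡⟨ sym p≡x+d ⟩
    p           ≡⟨ sym (m+[n∸m]≡n y≤p) ⟩
    y + e       ≡⟨ cong (_+ e) y≡q+d ⟩
    q + d + e   ≡⟨ xy∙z≈xz∙y q d e ⟩
    q + e + d   ∎)
  p≡q+e+d : p ≡ q + e + d
  p≡q+e+d = trans p≡x+d (cong (_+ d) x≡q+e)

square-gap≡0⇒ : ∀ {p x y} → x ≤ p → y ≤ p → 2 * (p ∸ x) * (p ∸ y) ≡ 0 → p ≡ x ⊎ p ≡ y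
square-gap≡0⇒ {p} {x} {y} x≤p y≤p gap≡0 with m*n≡0⇒m≡0∨n≡0 (2 * (p ∸ x)) gap≡0
... | inj₂ p∸y≡0 = inj₂ (≤-antisym (m∸n≡0⇒m≤n p∸y≡0) y≤p)
... | inj₁ 2[p∸x]≡0 with m*n≡0⇒m≡0∨n≡0 2 2[p∸x]≡0
...   | inj₂ p∸x≡0 = inj₁ (≤-antisym (m∸n≡0⇒m≤n p∸x≡0) x≤p)

sum-mono-≤ : {f g : Fin n → ℕ} → (∀ j → f j ≤ g j) → sum f ≤ sum g
sum-mono-≤ {zero}  _   = z≤n
sum-mono-≤ {suc n} f≤g = +-mono-≤ (f≤g zero) (sum-mono-≤ (f≤g ∘ suc))

sum-mono-≤-rigid : {f g : Fin n → ℕ} → (∀ j → f j ≤ g j) → sum g ≡ sum f → ∀ j → g j ≡ f j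
sum-mono-≤-rigid {suc n} f≤g eq zero =
  proj₁ (+-mono-≤-rigid (f≤g zero) (sum-mono-≤ (f≤g ∘ suc)) eq)
sum-mono-≤-rigid {suc n} f≤g eq (suc j) =
  sum-mono-≤-rigid (f≤g ∘ suc) (proj₂ (+-mono-≤-rigid (f≤g zero) (sum-mono-≤ (f≤g ∘ suc)) eq)) j

sum-except : {a : Fin n} (f g : Fin n → ℕ) → (∀ j → j ≢ a → f j ≡ g j) →
  sum f + g a ≡ sum g + f a
sum-except {suc n} {zero} f g same = begin
  f zero + sum (f ∘ suc) + g zero
    ≡⟨ cong (λ s → f zero + s + g zero) (sum-cong-≗ (λ j → same (suc j) λ ())) ⟩
  f zero + sum (g ∘ suc) + g zero
    ≡⟨ xy∙z≈zy∙x (f zero) (sum (g ∘ suc)) (g zero) ⟩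
  g zero + sum (g ∘ suc) + f zero ∎
sum-except {suc n} {suc a} f g same = begin
  f zero + sum (f ∘ suc) + g (suc a)
    ≡⟨ +-assoc (f zero) _ _ ⟩
  f zero + (sum (f ∘ suc) + g (suc a))
    ≡⟨ cong₂ _+_ (same zero λ ()) (sum-except (f ∘ suc) (g ∘ suc) (λ j j≢a → same (suc j) (j≢a ∘ suc-injective))) ⟩
  g zero + (sum (g ∘ suc) + f (suc a))
    ≡⟨ +-assoc (g zero) _ _ ⟨
  g zero + sum (g ∘ suc) + f (suc a) ∎

sum-except₂ : {a b : Fin n} → a ≢ b → (f g : Fin n → ℕ) →
  (∀ j → j ≢ a → j ≢ b → f j ≡ g j) → sum f + (g a + g b) ≡ sum g + (f a + f b)
sum-except₂ {a = a} {b} a≢b f g same = begin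
  sum f + (g a + g b)  ≡⟨ +-assoc (sum f) (g a) (g b) ⟨
  sum f + g a + g b    ≡⟨ cong (λ t → sum f + t + g b) (updateAt-updates a f) ⟨
  sum f + h a + g b    ≡⟨ cong (_+ g b) (sum-except h f h≗f) ⟨
  sum h + f a + g b    ≡⟨ xy∙z≈xz∙y (sum h) (f a) (g b) ⟩
  sum h + g b + f a    ≡⟨ cong (_+ f a) (sum-except h g h≗g) ⟩
  sum g + h b + f a    ≡⟨ cong (λ t → sum g + t + f a) (updateAt-minimal b a f (a≢b ∘ sym)) ⟩
  sum g + f b + f a    ≡⟨ xy∙z≈xz∙y (sum g) (f b) (f a) ⟩
  sum g + f a + f b    ≡⟨ +-assoc (sum g) (f a) (f b) ⟩
  sum g + (f a + f b)  ∎
  where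
  h : Fin _ → ℕ
  h = updateAt f a (λ _ → g a)
  h≗f : ∀ j → j ≢ a → h j ≡ f j
  h≗f j j≢a = updateAt-minimal j a f j≢a
  h≗g : ∀ j → j ≢ b → h j ≡ g j
  h≗g j j≢b with j ≟ a
  ... | yes refl = updateAt-updates a f
  ... | no j≢a   = trans (h≗f j j≢a) (same j j≢a j≢b)

sum-cong-except₂ : {a b : Fin n} → a ≢ b → {f g : Fin n → ℕ} →
  (∀ j → j ≢ a → j ≢ b → f j ≡ g j) → f a + f b ≡ g a + g b → sum f ≡ sum g
sum-cong-except₂ {a = a} {b} a≢b {f} {g} same pair = +-cancelʳ-≡ (f a + f b) (sum f) (sum g) (begin
  sum f + (f a + f b) ≡⟨ cong (sum f +_) pair ⟩
  sum f + (g a + g b) ≡⟨ sum-except₂ a≢b f g same ⟩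
  sum g + (f a + f b) ∎)

sumSquares : (Fin n → ℕ) → ℕ
sumSquares x = sum (λ i → x i * x i)

sumSquares-transfer : {a b : Fin n} → a ≢ b → (x y : Fin n → ℕ) →
  (∀ j → j ≢ a → j ≢ b → y j ≡ x j) → y a + y b ≡ x a + x b → x a ≤ y a → x b ≤ y a →
  sumSquares y ≡ sumSquares x + 2 * (y a ∸ x a) * (y a ∸ x b)
sumSquares-transfer {a = a} {b} a≢b x y same pair xa≤ya xb≤ya =
  +-cancelʳ-≡ (sq (x a) + sq (x b)) _ _ (begin
    sumSquares y + (sq (x a) + sq (x b))
      ≡⟨ sum-except₂ a≢b (λ i → sq (y i)) (λ i → sq (x i)) (λ j j≢a j≢b → cong sq (same j j≢a j≢b)) ⟩
    sumSquares x + (sq (y a) + sq (y b))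
      ≡⟨ cong (sumSquares x +_) (square-gap pair xa≤ya xb≤ya) ⟩
    sumSquares x + (sq (x a) + sq (x b) + gap)
      ≡⟨ x∙yz≈xz∙y (sumSquares x) (sq (x a) + sq (x b)) gap ⟩
    sumSquares x + gap + (sq (x a) + sq (x b)) ∎)
  where
  sq : ℕ → ℕ
  sq t = t * t
  gap : ℕ
  gap = 2 * (y a ∸ x a) * (y a ∸ x b)

b2n-∨-∧ : ∀ x y → b2n (x ∨ y) + b2n (x ∧ y) ≡ b2n x + b2n y
b2n-∨-∧ true  true  = refl
b2n-∨-∧ true  false = refl
b2n-∨-∧ false true  = refl
b2n-∨-∧ false false = refl

b2n-∨-∧-interchange : ∀ x y u v →
  (b2n (x ∨ y) + b2n (u ∨ v)) + (b2n (x ∧ y) + b2n (u ∧ v)) ≡ (b2n x + b2n u) + (b2n y + b2n v)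
b2n-∨-∧-interchange x y u v = begin
  (b2n (x ∨ y) + b2n (u ∨ v)) + (b2n (x ∧ y) + b2n (u ∧ v))
    ≡⟨ interchange (b2n (x ∨ y)) _ _ _ ⟩
  (b2n (x ∨ y) + b2n (x ∧ y)) + (b2n (u ∨ v) + b2n (u ∧ v))
    ≡⟨ cong₂ _+_ (b2n-∨-∧ x y) (b2n-∨-∧ u v) ⟩
  (b2n x + b2n y) + (b2n u + b2n v)
    ≡⟨ interchange (b2n x) _ _ _ ⟩
  (b2n x + b2n u) + (b2n y + b2n v) ∎

b2n-∨ˡ : ∀ x y → b2n x ≤ b2n (x ∨ y)
b2n-∨ˡ true  y = ≤-refl
b2n-∨ˡ false y = z≤n

b2n-∨ʳ : ∀ x y → b2n y ≤ b2n (x ∨ y)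
b2n-∨ʳ true  true  = ≤-refl
b2n-∨ʳ true  false = z≤n
b2n-∨ʳ false y     = ≤-refl

b2n-∨≡ˡ⇒∨≡ˡ : ∀ x y → b2n (x ∨ y) ≡ b2n x → x ∨ y ≡ x
b2n-∨≡ˡ⇒∨≡ˡ true  y     _ = refl
b2n-∨≡ˡ⇒∨≡ˡ false false _ = refl

b2n-∨≡ʳ⇒∨≡ʳ : ∀ x y → b2n (x ∨ y) ≡ b2n y → x ∨ y ≡ y
b2n-∨≡ʳ⇒∨≡ʳ true  true _ = refl
b2n-∨≡ʳ⇒∨≡ʳ false y    _ = refl

∨≡ˡ⇒∧≡ʳ : ∀ x y → x ∨ y ≡ x → x ∧ y ≡ y
∨≡ˡ⇒∧≡ʳ true  y _  = refl
∨≡ˡ⇒∧≡ʳ false y eq = sym eq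

∨≡ʳ⇒∧≡ˡ : ∀ x y → x ∨ y ≡ y → x ∧ y ≡ x
∨≡ʳ⇒∧≡ˡ true  y eq = sym eq
∨≡ʳ⇒∧≡ˡ false y _  = refl

-- Degrees, potential and isomorphisms

incidence : Matrix n → Fin n → Fin n → ℕ
incidence A i j = b2n (A i j) + b2n (A j i)

degree : Matrix n → Fin n → ℕ
degree A i = sum (incidence A i)

potential : Matrix n → ℕ
potential A = sumSquares (degree A)

Loopless : Matrix n → Set
Loopless {n} A = ∀ (i : Fin n) → A i i ≡ false

≅ᴹ-isEquivalence : IsEquivalence (_≅ᴹ_ {n})
≅ᴹ-isEquivalence = record
  { refl  = id , λ i j → refl
  ; sym   = λ { {A} {B} (σ , B∘σ≡A) → flip σ , λ i j →
              trans (sym (B∘σ≡A (σ ⟨$⟩ˡ i) (σ ⟨$⟩ˡ j))) (cong₂ B (inverseʳ σ) (inverseʳ σ)) }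
  ; trans = λ { (σ , B∘σ≡A) (ρ , C∘ρ≡B) → σ ∘ₚ ρ , λ i j →
              trans (C∘ρ≡B (σ ⟨$⟩ʳ i) (σ ⟨$⟩ʳ j)) (B∘σ≡A i j) }
  }

module ≅ᴹ {n} = IsEquivalence (≅ᴹ-isEquivalence {n})

pointwise⇒≅ᴹ : {A B : Matrix n} → (∀ i j → B i j ≡ A i j) → A ≅ᴹ B
pointwise⇒≅ᴹ B≗A = id , B≗A

degree-≅ᴹ : {A B : Matrix n} ((σ , _) : A ≅ᴹ B) → ∀ i → degree B (σ ⟨$⟩ʳ i) ≡ degree A i
degree-≅ᴹ {B = B} (σ , B∘σ≡A) i = trans (sum-permute (incidence B (σ ⟨$⟩ʳ i)) σ)
  (sum-cong-≗ (λ j → cong₂ _+_ (cong b2n (B∘σ≡A i j)) (cong b2n (B∘σ≡A j i))))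

potential-≅ᴹ : {A B : Matrix n} → A ≅ᴹ B → potential A ≡ potential B
potential-≅ᴹ {B = B} A≅B@(σ , _) = sym (trans (sum-permute (λ i → degree B i * degree B i) σ)
  (sum-cong-≗ (λ i → cong (λ d → d * d) (degree-≅ᴹ {B = B} A≅B i))))

==-refl : (i : Fin n) → (i == i) ≡ true
==-refl i = dec-true (i ≟ i) refl

==-≢ : {i j : Fin n} → i ≢ j → (i == j) ≡ false
==-≢ {i = i} {j} i≢j = dec-false (i ≟ j) i≢j

data Corner (a b : Fin n) : Fin n → Set where
  at-a : Corner a b a
  at-b : Corner a b b

data Position (a b j : Fin n) : Set where
  corner    : Corner a b j → Position a b j
  elsewhere : j ≢ a → j ≢ b → Position a b j

position : (a b j : Fin n) → Position a b j
position a b j with j ≟ a | j ≟ b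
... | yes refl | _        = corner at-a
... | no _     | yes refl = corner at-b
... | no j≢a   | no j≢b   = elsewhere j≢a j≢b

module KelmansEntries (A : Matrix n) {a b : Fin n} (a≢b : a ≢ b) where

  K : Matrix n
  K = kelmans A a b

  kelmans-corner : ∀ {i j} → Corner a b i → Corner a b j → K i j ≡ A i j
  kelmans-corner at-a at-a rewrite ==-refl a                               = refl
  kelmans-corner at-a at-b rewrite ==-refl a | ==-refl b | ==-≢ (a≢b ∘ sym) = refl
  kelmans-corner at-b at-a rewrite ==-refl a | ==-refl b | ==-≢ (a≢b ∘ sym) = refl
  kelmans-corner at-b at-b rewrite ==-refl b | ==-≢ (a≢b ∘ sym)             = refl

  kelmans-row-a : ∀ j → j ≢ a → j ≢ b → K a j ≡ (A a j ∨ A b j)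
  kelmans-row-a j j≢a j≢b rewrite ==-refl a | ==-≢ j≢a | ==-≢ j≢b = refl

  kelmans-row-b : ∀ j → j ≢ a → j ≢ b → K b j ≡ (A a j ∧ A b j)
  kelmans-row-b j j≢a j≢b rewrite ==-refl b | ==-≢ (a≢b ∘ sym) | ==-≢ j≢a | ==-≢ j≢b = refl

  kelmans-column-a : ∀ i → i ≢ a → i ≢ b → K i a ≡ (A i a ∨ A i b)
  kelmans-column-a i i≢a i≢b rewrite ==-refl a | ==-≢ i≢a | ==-≢ i≢b = refl

  kelmans-column-b : ∀ i → i ≢ a → i ≢ b → K i b ≡ (A i a ∧ A i b)
  kelmans-column-b i i≢a i≢b rewrite ==-refl b | ==-≢ (a≢b ∘ sym) | ==-≢ i≢a | ==-≢ i≢b = refl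

  kelmans-elsewhere : ∀ i j → i ≢ a → i ≢ b → j ≢ a → j ≢ b → K i j ≡ A i j
  kelmans-elsewhere i j i≢a i≢b j≢a j≢b rewrite ==-≢ i≢a | ==-≢ i≢b | ==-≢ j≢a | ==-≢ j≢b = refl

  kelmans-diagonal : ∀ i → K i i ≡ A i i
  kelmans-diagonal i with position a b i
  ... | corner c          = kelmans-corner c c
  ... | elsewhere i≢a i≢b = kelmans-elsewhere i i i≢a i≢b i≢a i≢b

transpose-matchˡ : (a b : Fin n) → transpose a b ⟨$⟩ʳ a ≡ b
transpose-matchˡ a b rewrite ==-refl a = refl

transpose-matchʳ : {a b : Fin n} → a ≢ b → transpose a b ⟨$⟩ʳ b ≡ a
transpose-matchʳ {a = a} {b} a≢b rewrite ==-≢ (a≢b ∘ sym) | ==-refl b = refl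

transpose-other : {a b j : Fin n} → j ≢ a → j ≢ b → transpose a b ⟨$⟩ʳ j ≡ j
transpose-other j≢a j≢b rewrite ==-≢ j≢a | ==-≢ j≢b = refl

-- One Kelmans step

module KelmansStep (A : Matrix n) {a b : Fin n} (a≢b : a ≢ b)
                   (no-arc : A a b ≡ A b a) (same-loop : A a a ≡ A b b) where

  open KelmansEntries A a≢b

  τ : Fin n → Fin n
  τ j = transpose a b ⟨$⟩ʳ j

  incidence-corner : ∀ {i j} → Corner a b i → Corner a b j → incidence K i j ≡ incidence A i j
  incidence-corner ci cj = cong₂ _+_ (cong b2n (kelmans-corner ci cj)) (cong b2n (kelmans-corner cj ci))

  incidence-a-elsewhere : ∀ j → j ≢ a → j ≢ b →
    incidence K a j ≡ b2n (A a j ∨ A b j) + b2n (A j a ∨ A j b)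
  incidence-a-elsewhere j j≢a j≢b =
    cong₂ _+_ (cong b2n (kelmans-row-a j j≢a j≢b)) (cong b2n (kelmans-column-a j j≢a j≢b))

  incidence-b-elsewhere : ∀ j → j ≢ a → j ≢ b →
    incidence K b j ≡ b2n (A a j ∧ A b j) + b2n (A j a ∧ A j b)
  incidence-b-elsewhere j j≢a j≢b =
    cong₂ _+_ (cong b2n (kelmans-row-b j j≢a j≢b)) (cong b2n (kelmans-column-b j j≢a j≢b))

  degree-elsewhere : ∀ i → i ≢ a → i ≢ b → degree K i ≡ degree A i
  degree-elsewhere i i≢a i≢b = sum-cong-except₂ a≢b same (begin
    incidence K i a + incidence K i b
      ≡⟨ cong₂ _+_ (cong₂ _+_ (cong b2n (kelmans-column-a i i≢a i≢b)) (cong b2n (kelmans-row-a i i≢a i≢b)))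
                   (cong₂ _+_ (cong b2n (kelmans-column-b i i≢a i≢b)) (cong b2n (kelmans-row-b i i≢a i≢b))) ⟩
    (b2n (A i a ∨ A i b) + b2n (A a i ∨ A b i)) + (b2n (A i a ∧ A i b) + b2n (A a i ∧ A b i))
      ≡⟨ b2n-∨-∧-interchange (A i a) (A i b) (A a i) (A b i) ⟩
    incidence A i a + incidence A i b ∎)
    where
    same : ∀ j → j ≢ a → j ≢ b → incidence K i j ≡ incidence A i j
    same j j≢a j≢b = cong₂ _+_ (cong b2n (kelmans-elsewhere i j i≢a i≢b j≢a j≢b))
                               (cong b2n (kelmans-elsewhere j i j≢a j≢b i≢a i≢b))

  degree-pair : degree K a + degree K b ≡ degree A a + degree A b
  degree-pair = begin
    degree K a + degree K b                         ≡⟨ ∑-distrib-+ (incidence K a) (incidence K b) ⟨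
    sum (λ j → incidence K a j + incidence K b j)   ≡⟨ sum-cong-≗ pair ⟩
    sum (λ j → incidence A a j + incidence A b j)   ≡⟨ ∑-distrib-+ (incidence A a) (incidence A b) ⟩
    degree A a + degree A b                         ∎
    where
    pair : ∀ j → incidence K a j + incidence K b j ≡ incidence A a j + incidence A b j
    pair j with position a b j
    ... | corner c = cong₂ _+_ (incidence-corner at-a c) (incidence-corner at-b c)
    ... | elsewhere j≢a j≢b = begin
      incidence K a j + incidence K b j
        ≡⟨ cong₂ _+_ (incidence-a-elsewhere j j≢a j≢b) (incidence-b-elsewhere j j≢a j≢b) ⟩
      (b2n (A a j ∨ A b j) + b2n (A j a ∨ A j b)) + (b2n (A a j ∧ A b j) + b2n (A j a ∧ A j b))
        ≡⟨ b2n-∨-∧-interchange (A a j) (A b j) (A j a) (A j b) ⟩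
      incidence A a j + incidence A b j ∎

  incidence-a-grows : ∀ j → incidence A a j ≤ incidence K a j
  incidence-a-grows j with position a b j
  ... | corner c          = ≤-reflexive (sym (incidence-corner at-a c))
  ... | elsewhere j≢a j≢b rewrite incidence-a-elsewhere j j≢a j≢b =
    +-mono-≤ (b2n-∨ˡ (A a j) (A b j)) (b2n-∨ˡ (A j a) (A j b))

  incidence-b-below-a : ∀ j → incidence A b j ≤ incidence K a (τ j)
  incidence-b-below-a j with position a b j
  ... | corner at-a rewrite transpose-matchˡ a b = ≤-reflexive (begin
    incidence A b a ≡⟨ +-comm (b2n (A b a)) (b2n (A a b)) ⟩
    incidence A a b ≡⟨ incidence-corner at-a at-b ⟨
    incidence K a b ∎)
  ... | corner at-b rewrite transpose-matchʳ a≢b = ≤-reflexive (begin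
    incidence A b b ≡⟨ cong (λ t → b2n t + b2n t) same-loop ⟨
    incidence A a a ≡⟨ incidence-corner at-a at-a ⟨
    incidence K a a ∎)
  ... | elsewhere j≢a j≢b rewrite transpose-other j≢a j≢b | incidence-a-elsewhere j j≢a j≢b =
    +-mono-≤ (b2n-∨ʳ (A a j) (A b j)) (b2n-∨ʳ (A j a) (A j b))

  degree-a-grows : degree A a ≤ degree K a
  degree-a-grows = sum-mono-≤ incidence-a-grows

  degree-permute : sum (λ j → incidence K a (τ j)) ≡ degree K a
  degree-permute = sym (sum-permute (incidence K a) (transpose a b))

  degree-b-below-a : degree A b ≤ degree K a
  degree-b-below-a = ≤-trans (sum-mono-≤ incidence-b-below-a) (≤-reflexive degree-permute)

  potential-gap : potential K ≡ potential A + 2 * (degree K a ∸ degree A a) * (degree K a ∸ degree A b)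
  potential-gap = sumSquares-transfer a≢b (degree A) (degree K)
    degree-elsewhere degree-pair degree-a-grows degree-b-below-a

  a-absorbs-b⇒unchanged : (∀ j → j ≢ a → j ≢ b → (A a j ∨ A b j ≡ A a j) × (A j a ∨ A j b ≡ A j a)) →
    ∀ i j → K i j ≡ A i j
  a-absorbs-b⇒unchanged absorbs i j with position a b i | position a b j
  ... | corner ci | corner cj = kelmans-corner ci cj
  ... | corner at-a | elsewhere j≢a j≢b =
    trans (kelmans-row-a j j≢a j≢b) (proj₁ (absorbs j j≢a j≢b))
  ... | corner at-b | elsewhere j≢a j≢b =
    trans (kelmans-row-b j j≢a j≢b) (∨≡ˡ⇒∧≡ʳ (A a j) (A b j) (proj₁ (absorbs j j≢a j≢b)))
  ... | elsewhere i≢a i≢b | corner at-a =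
    trans (kelmans-column-a i i≢a i≢b) (proj₂ (absorbs i i≢a i≢b))
  ... | elsewhere i≢a i≢b | corner at-b =
    trans (kelmans-column-b i i≢a i≢b) (∨≡ˡ⇒∧≡ʳ (A i a) (A i b) (proj₂ (absorbs i i≢a i≢b)))
  ... | elsewhere i≢a i≢b | elsewhere j≢a j≢b = kelmans-elsewhere i j i≢a i≢b j≢a j≢b

  b-absorbs-a⇒swapped : (∀ j → j ≢ a → j ≢ b → (A a j ∨ A b j ≡ A b j) × (A j a ∨ A j b ≡ A j b)) →
    ∀ i j → K (τ i) (τ j) ≡ A i j
  b-absorbs-a⇒swapped absorbs i j with position a b i | position a b j
  ... | corner at-a | corner at-a rewrite transpose-matchˡ a b =
    trans (kelmans-corner at-b at-b) (sym same-loop)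
  ... | corner at-a | corner at-b rewrite transpose-matchˡ a b | transpose-matchʳ a≢b =
    trans (kelmans-corner at-b at-a) (sym no-arc)
  ... | corner at-b | corner at-a rewrite transpose-matchˡ a b | transpose-matchʳ a≢b =
    trans (kelmans-corner at-a at-b) no-arc
  ... | corner at-b | corner at-b rewrite transpose-matchʳ a≢b =
    trans (kelmans-corner at-a at-a) same-loop
  ... | corner at-a | elsewhere j≢a j≢b rewrite transpose-matchˡ a b | transpose-other j≢a j≢b =
    trans (kelmans-row-b j j≢a j≢b) (∨≡ʳ⇒∧≡ˡ (A a j) (A b j) (proj₁ (absorbs j j≢a j≢b)))
  ... | corner at-b | elsewhere j≢a j≢b rewrite transpose-matchʳ a≢b | transpose-other j≢a j≢b =
    trans (kelmans-row-a j j≢a j≢b) (proj₁ (absorbs j j≢a j≢b))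
  ... | elsewhere i≢a i≢b | corner at-a rewrite transpose-matchˡ a b | transpose-other i≢a i≢b =
    trans (kelmans-column-b i i≢a i≢b) (∨≡ʳ⇒∧≡ˡ (A i a) (A i b) (proj₂ (absorbs i i≢a i≢b)))
  ... | elsewhere i≢a i≢b | corner at-b rewrite transpose-matchʳ a≢b | transpose-other i≢a i≢b =
    trans (kelmans-column-a i i≢a i≢b) (proj₂ (absorbs i i≢a i≢b))
  ... | elsewhere i≢a i≢b | elsewhere j≢a j≢b rewrite transpose-other i≢a i≢b | transpose-other j≢a j≢b =
    kelmans-elsewhere i j i≢a i≢b j≢a j≢b

  degree-a-kept⇒a-absorbs-b : degree K a ≡ degree A a → ∀ j → j ≢ a → j ≢ b →
    (A a j ∨ A b j ≡ A a j) × (A j a ∨ A j b ≡ A j a)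
  degree-a-kept⇒a-absorbs-b kept j j≢a j≢b =
    let (row , column) = +-mono-≤-rigid (b2n-∨ˡ (A a j) (A b j)) (b2n-∨ˡ (A j a) (A j b))
          (trans (sym (incidence-a-elsewhere j j≢a j≢b)) (sum-mono-≤-rigid incidence-a-grows kept j))
    in b2n-∨≡ˡ⇒∨≡ˡ (A a j) (A b j) row , b2n-∨≡ˡ⇒∨≡ˡ (A j a) (A j b) column

  degree-a-from-b⇒b-absorbs-a : degree K a ≡ degree A b → ∀ j → j ≢ a → j ≢ b →
    (A a j ∨ A b j ≡ A b j) × (A j a ∨ A j b ≡ A j b)
  degree-a-from-b⇒b-absorbs-a d≡ j j≢a j≢b =
    let incidence≡ = sum-mono-≤-rigid incidence-b-below-a (trans degree-permute d≡) j
        (row , column) = +-mono-≤-rigid (b2n-∨ʳ (A a j) (A b j)) (b2n-∨ʳ (A j a) (A j b))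
          (trans (sym (incidence-a-elsewhere j j≢a j≢b))
                 (subst (λ t → incidence K a t ≡ incidence A b j) (transpose-other j≢a j≢b) incidence≡))
    in b2n-∨≡ʳ⇒∨≡ʳ (A a j) (A b j) row , b2n-∨≡ʳ⇒∨≡ʳ (A j a) (A j b) column

  potential-kept⇒≅ᴹ : potential K ≡ potential A → A ≅ᴹ K
  potential-kept⇒≅ᴹ kept with square-gap≡0⇒ degree-a-grows degree-b-below-a gap≡0
    where
    gap≡0 : 2 * (degree K a ∸ degree A a) * (degree K a ∸ degree A b) ≡ 0
    gap≡0 = +-cancelˡ-≡ (potential A) _ 0 (trans (sym potential-gap) (trans kept (sym (+-identityʳ _))))
  ... | inj₁ d≡ = pointwise⇒≅ᴹ (a-absorbs-b⇒unchanged (degree-a-kept⇒a-absorbs-b d≡))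
  ... | inj₂ d≡ = transpose a b , b-absorbs-a⇒swapped (degree-a-from-b⇒b-absorbs-a d≡)

kstep-loopless : {A B : Matrix n} → Loopless A → KStep A B → Loopless B
kstep-loopless {A = A} loopless (a , b , a≢b , _ , B≗K) i =
  trans (B≗K i i) (trans (kelmans-diagonal i) (loopless i))
  where open KelmansEntries A a≢b

kstep-potential-≤ : {A B : Matrix n} → Loopless A → KStep A B → potential A ≤ potential B
kstep-potential-≤ {A = A} {B} loopless (a , b , a≢b , no-arc , B≗K) =
  ≤-trans (m≤m+n (potential A) _)
    (≤-reflexive (trans (sym potential-gap) (potential-≅ᴹ {B = B} (pointwise⇒≅ᴹ B≗K))))
  where open KelmansStep A a≢b no-arc (trans (loopless a) (sym (loopless b)))

kstep-potential-kept⇒≅ᴹ : {A B : Matrix n} → Loopless A → KStep A B → potential B ≡ potential A → A ≅ᴹ B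
kstep-potential-kept⇒≅ᴹ {A = A} {B} loopless (a , b , a≢b , no-arc , B≗K) kept =
  ≅ᴹ.trans {i = A} {j = K} {k = B} (potential-kept⇒≅ᴹ (trans (potential-≅ᴹ {B = B} K≅B) kept)) K≅B
  where
  open KelmansEntries A a≢b
  open KelmansStep A a≢b no-arc (trans (loopless a) (sym (loopless b)))
  K≅B : K ≅ᴹ B
  K≅B = pointwise⇒≅ᴹ B≗K

kstar-potential-≤ : {A B : Matrix n} → Loopless A → Star KStep A B → potential A ≤ potential B
kstar-potential-≤ loopless ε          = ≤-refl
kstar-potential-≤ loopless (s ◅ steps) =
  ≤-trans (kstep-potential-≤ loopless s) (kstar-potential-≤ (kstep-loopless loopless s) steps)

kstar-potential-≤⇒≅ᴹ : {A B : Matrix n} → Loopless A → Star KStep A B → potential B ≤ potential A → A ≅ᴹ B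
kstar-potential-≤⇒≅ᴹ loopless ε           _ = ≅ᴹ.refl
kstar-potential-≤⇒≅ᴹ {A = A} {B} loopless (_◅_ {j = A′} s steps) B≤A =
  ≅ᴹ.trans {i = A} {j = A′} {k = B} (kstep-potential-kept⇒≅ᴹ loopless s (≤-antisym (≤-trans rest B≤A) first))
           (kstar-potential-≤⇒≅ᴹ (kstep-loopless loopless s) steps (≤-trans B≤A first))
  where
  first : potential A ≤ potential A′
  first = kstep-potential-≤ loopless s
  rest : potential A′ ≤ potential B
  rest = kstar-potential-≤ (kstep-loopless loopless s) steps

-- Replaying Kelmans sequences along isomorphisms

permute-== : (σ : Permutation′ n) (i j : Fin n) → ((σ ⟨$⟩ʳ i) == (σ ⟨$⟩ʳ j)) ≡ (i == j)
permute-== σ i j with (σ ⟨$⟩ʳ i) ≟ (σ ⟨$⟩ʳ j) | i ≟ j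
... | yes _     | yes _   = refl
... | no _      | no _    = refl
... | yes σi≡σj | no i≢j  = ⊥-elim (i≢j (trans (sym (inverseˡ σ)) (trans (cong (σ ⟨$⟩ˡ_) σi≡σj) (inverseˡ σ))))
... | no σi≢σj  | yes i≡j = ⊥-elim (σi≢σj (cong (σ ⟨$⟩ʳ_) i≡j))

kelmans-permute : {A B : Matrix n} ((σ , _) : A ≅ᴹ B) → ∀ a b i j →
  kelmans B (σ ⟨$⟩ʳ a) (σ ⟨$⟩ʳ b) (σ ⟨$⟩ʳ i) (σ ⟨$⟩ʳ j) ≡ kelmans A a b i j
kelmans-permute (σ , B∘σ≡A) a b i j
  rewrite permute-== σ i a | permute-== σ i b | permute-== σ j a | permute-== σ j b
        | B∘σ≡A i j | B∘σ≡A a j | B∘σ≡A b j | B∘σ≡A i a | B∘σ≡A i b = refl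

kstep-transport : {A B C : Matrix n} → A ≅ᴹ B → KStep B C → ∃ λ D → KStep A D × D ≅ᴹ C
kstep-transport {A = A} {B} {C} A≅B@(σ , B∘σ≡A) (a , b , a≢b , no-arc , C≗K) =
  kelmans A a′ b′ , (a′ , b′ , a′≢b′ , no-arc′ , λ i j → refl) , (σ , C∘σ≡K′)
  where
  a′ b′ : Fin _
  a′ = σ ⟨$⟩ˡ a
  b′ = σ ⟨$⟩ˡ b
  a′≢b′ : a′ ≢ b′
  a′≢b′ a′≡b′ = a≢b (trans (sym (inverseʳ σ)) (trans (cong (σ ⟨$⟩ʳ_) a′≡b′) (inverseʳ σ)))
  no-arc′ : A a′ b′ ≡ A b′ a′
  no-arc′ = begin
    A a′ b′                         ≡⟨ B∘σ≡A a′ b′ ⟨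
    B (σ ⟨$⟩ʳ a′) (σ ⟨$⟩ʳ b′)       ≡⟨ cong₂ B (inverseʳ σ) (inverseʳ σ) ⟩
    B a b                           ≡⟨ no-arc ⟩
    B b a                           ≡⟨ cong₂ B (inverseʳ σ) (inverseʳ σ) ⟨
    B (σ ⟨$⟩ʳ b′) (σ ⟨$⟩ʳ a′)       ≡⟨ B∘σ≡A b′ a′ ⟩
    A b′ a′                         ∎
  C∘σ≡K′ : ∀ i j → C (σ ⟨$⟩ʳ i) (σ ⟨$⟩ʳ j) ≡ kelmans A a′ b′ i j
  C∘σ≡K′ i j = begin
    C (σ ⟨$⟩ʳ i) (σ ⟨$⟩ʳ j)                               ≡⟨ C≗K _ _ ⟩
    kelmans B a b (σ ⟨$⟩ʳ i) (σ ⟨$⟩ʳ j)                   ≡⟨ cong₂ (λ x y → kelmans B x y (σ ⟨$⟩ʳ i) (σ ⟨$⟩ʳ j))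
                                                                  (inverseʳ σ) (inverseʳ σ) ⟨
    kelmans B (σ ⟨$⟩ʳ a′) (σ ⟨$⟩ʳ b′) (σ ⟨$⟩ʳ i) (σ ⟨$⟩ʳ j) ≡⟨ kelmans-permute {B = B} A≅B a′ b′ i j ⟩
    kelmans A a′ b′ i j                                   ∎

kstar-transport : {A B C : Matrix n} → A ≅ᴹ B → Star KStep B C → ∃ λ D → Star KStep A D × D ≅ᴹ C
kstar-transport A≅B ε = _ , ε , A≅B
kstar-transport A≅B (s ◅ steps) with kstep-transport A≅B s
... | D , s′ , D≅B′ with kstar-transport D≅B′ steps
...   | E , steps′ , E≅C = E , s′ ◅ steps′ , E≅C

module _ {n m : ℕ} where

  ≼-reflexive : {G H : MG n m} → G ≅ H → G ≼ H
  ≼-reflexive {G} G≅H = adj (graph G) , ε , G≅H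

  ≼-trans : {G H I : MG n m} → G ≼ H → H ≼ I → G ≼ I
  ≼-trans {I = I} (K , steps , K≅H) (L , steps′ , L≅I) with kstar-transport K≅H steps′
  ... | M , steps″ , M≅L = M , steps ◅◅ steps″ , ≅ᴹ.trans {i = M} {j = L} {k = adj (graph I)} M≅L L≅I

  ≼-antisym : {G H : MG n m} → G ≼ H → H ≼ G → G ≅ H
  ≼-antisym {G} {H} (K , steps , K≅H) (L , steps′ , L≅G) =
    ≅ᴹ.trans {i = adj (graph G)} {j = K} {k = adj (graph H)}
      (kstar-potential-≤⇒≅ᴹ (loopless (graph G)) steps K≤G) K≅H
    where
    K≤G : potential K ≤ potential (adj (graph G))
    K≤G = ≤-trans (≤-reflexive (potential-≅ᴹ {B = adj (graph H)} K≅H))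
            (≤-trans (kstar-potential-≤ (loopless (graph H)) steps′)
                     (≤-reflexive (potential-≅ᴹ {B = adj (graph G)} L≅G)))

lemma3p2 : (n m : ℕ) → 0 < n → 0 < m →
    IsPartialOrder (_≅_ {n} {m}) (_≼_ {n} {m})
lemma3p2 n m _ _ = record
  { isPreorder = record
    { isEquivalence = On.isEquivalence (adj ∘ graph) ≅ᴹ-isEquivalence
    ; reflexive     = λ {G} {H} → ≼-reflexive {G = G} {H}
    ; trans         = λ {G} {H} {I} → ≼-trans {G = G} {H} {I}
    }
  ; antisym = λ {G} {H} → ≼-antisym {G = G} {H}
  }
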